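{- Let $\varphi_1,\varphi_2,\varphi_3$ be CNF formulas, viewed as finite sets of clauses (they may overlap), and let $\varphi=\varphi_1\cup\varphi_2\cup\varphi_3$. Let $\sigma:\mathrm{lits}(\varphi_2)\to\mathrm{lits}(\varphi_3)$ be a propositionally-consistent literal map such that $\sigma(\varphi_2)\equiv\varphi_3$. Let $c$ be a clause over the variables of $\varphi_2$ with $\varphi_2\models c$ (e.g., a conflict clause learned from the clauses of $\varphi_2$). Then $\varphi$ and $\varphi\cup\{\sigma(c)\}$ have exactly the same satisfying assignments.
   Context: A clause is a disjunction (set) of literals; a CNF formula is a set of clauses. $\mathrm{lits}(\psi)$ denotes the set of literals (a variable or its negation) over the variables occurring in $\psi$. A literal map $\sigma$ is propositionally consistent if for all variables $v_1,v_2$: $\sigma(v_1)=v_2$ implies $\sigma(\bar v_1)=\bar v_2$, and $\sigma(v_1)=\bar v_2$ implies $\sigma(\bar v_1)=v_2$. A map on literals is applied to a clause by applying it to each literal, and to a set of clauses by applying it to each clause. For sets of clauses, $\psi\equiv\psi'$ means syntactic equality modulo the order of clauses and the order of literals within clauses. $\psi\models c$ means every assignment satisfying $\psi$ satisfies $c$. -}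

module Defs where

open import Data.Nat using (ℕ)
open import Data.Bool using (Bool; true; false; not)
open import Data.List using (List; map; _++_; _∷_)
open import Data.List.Membership.Propositional using (_∈_)
open import Data.List.Relation.Unary.All using (All)
open import Data.List.Relation.Unary.Any using (Any)
open import Data.Product using (Σ; ∃; _×_)
open import Function.Bundles using (_⇔_)
open import Relation.Binary.PropositionalEquality using (_≡_)

Var : Set
Var = ℕ

data Lit : Set where
  pos : Var → Lit
  neg : Var → Lit

var : Lit → Var
var (pos v) = v
var (neg v) = v

Clause : Set
Clause = List Lit

CNF : Set
CNF = List Clause

_occursIn_ : Var → CNF → Set
v occursIn ψ = Any (λ c → Any (λ l → var l ≡ v) c) ψ

_∈lits_ : Lit → CNF → Set
l ∈lits ψ = var l occursIn ψ

Assignment : Set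
Assignment = Var → Bool

evalLit : Assignment → Lit → Bool
evalLit α (pos v) = α v
evalLit α (neg v) = not (α v)

_⊨C_ : Assignment → Clause → Set
α ⊨C c = Any (λ l → evalLit α l ≡ true) c

_⊨_ : Assignment → CNF → Set
α ⊨ ψ = All (λ c → α ⊨C c) ψ

_entails_ : CNF → Clause → Set
ψ entails c = ∀ (α : Assignment) → α ⊨ ψ → α ⊨C c

mapClause : (Lit → Lit) → Clause → Clause
mapClause σ c = map σ c

mapCNF : (Lit → Lit) → CNF → CNF
mapCNF σ ψ = map (mapClause σ) ψ

-- σ : lits(ψ) → lits(ψ'), represented by a function on all literals whose
-- behaviour matters only on lits(ψ); it must send lits(ψ) into lits(ψ').
MapsLits : (Lit → Lit) → CNF → CNF → Set
MapsLits σ ψ ψ' = ∀ (l : Lit) → l ∈lits ψ → σ l ∈lits ψ'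

PropConsistent : (Lit → Lit) → CNF → Set
PropConsistent σ ψ =
  ∀ (v₁ v₂ : Var) → v₁ occursIn ψ →
    (σ (pos v₁) ≡ pos v₂ → σ (neg v₁) ≡ neg v₂) ×
    (σ (pos v₁) ≡ neg v₂ → σ (neg v₁) ≡ pos v₂)

_≡C_ : Clause → Clause → Set
c ≡C c' = ∀ (l : Lit) → (l ∈ c) ⇔ (l ∈ c')

_≡CNF_ : CNF → CNF → Set
ψ ≡CNF ψ' =
  (All (λ c → Any (λ c' → c ≡C c') ψ') ψ) ×
  (All (λ c' → Any (λ c → c ≡C c') ψ) ψ')

ClauseOver : Clause → CNF → Set
ClauseOver c ψ = All (λ l → l ∈lits ψ) c

{-# OPTIONS --safe #-}
module Submission where

-- Pull an assignment α back along σ by giving v the value of σ(v) under α.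
-- Propositional consistency makes σ(¬v) evaluate to the negation of σ(v), so the
-- pullback satisfies a clause d over φ₂ exactly when α satisfies σ(d). Hence
-- φ₂ ⊨ c transports to σ(φ₂) ⊨ σ(c), and as every clause of σ(φ₂) occurs in φ₃,
-- every model of φ already satisfies σ(c).

open import Defs
open import Data.Bool.Properties using (not-involutive)
open import Data.List using (_++_; _∷_)
open import Data.List.Membership.Propositional using (_∈_; find; lose)
open import Data.List.Membership.Propositional.Properties using (∈-map⁺)
open import Data.List.Relation.Unary.All as All using (All; _∷_)
open import Data.List.Relation.Unary.All.Properties using (++⁻ʳ)
open import Data.List.Relation.Unary.Any using (Any)
open import Data.List.Relation.Unary.Any.Properties using (map⁺; map⁻)
open import Data.Product using (_,_; proj₁; proj₂)
open import Function.Bundles using (_⇔_; mk⇔; Equivalence)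
open import Relation.Binary.PropositionalEquality using (_≡_; refl; sym; trans; cong)

pullback : (Lit → Lit) → Assignment → Assignment
pullback σ α v = evalLit α (σ (pos v))

module _ {σ : Lit → Lit} {ψ : CNF} (consistent : PropConsistent σ ψ) (α : Assignment) where

  evalLit-pullback : ∀ l → var l occursIn ψ → evalLit (pullback σ α) l ≡ evalLit α (σ l)
  evalLit-pullback (pos v) _ = refl
  evalLit-pullback (neg v) occ with σ (pos v) in σv
  ... | pos w = sym (cong (evalLit α) (proj₁ (consistent v w occ) σv))
  ... | neg w = trans (not-involutive (α w))
                      (sym (cong (evalLit α) (proj₂ (consistent v w occ) σv)))

  ⊨C-pullback : ∀ {d} → ClauseOver d ψ → (pullback σ α ⊨C d) ⇔ (α ⊨C mapClause σ d)
  ⊨C-pullback {d} over = mk⇔ to from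
    where
    to : pullback σ α ⊨C d → α ⊨C mapClause σ d
    to sat = let l , l∈d , l-true = find sat in
      map⁺ (lose l∈d (trans (sym (evalLit-pullback l (All.lookup over l∈d))) l-true))

    from : α ⊨C mapClause σ d → pullback σ α ⊨C d
    from sat = let l , l∈d , l-true = find (map⁻ sat) in
      lose l∈d (trans (evalLit-pullback l (All.lookup over l∈d)) l-true)

  ⊨-pullback : α ⊨ mapCNF σ ψ → pullback σ α ⊨ ψ
  ⊨-pullback sat = All.tabulate λ d∈ψ →
    Equivalence.from (⊨C-pullback (member-clauseOver d∈ψ)) (All.lookup sat (∈-map⁺ (mapClause σ) d∈ψ))
    where
    member-clauseOver : ∀ {d} → d ∈ ψ → ClauseOver d ψ
    member-clauseOver d∈ψ = All.tabulate λ l∈d → lose d∈ψ (lose l∈d refl)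

entails-image : ∀ {σ : Lit → Lit} {ψ c} → PropConsistent σ ψ → ClauseOver c ψ →
                ψ entails c → mapCNF σ ψ entails mapClause σ c
entails-image {σ} consistent over ψ⊨c α sat =
  Equivalence.to (⊨C-pullback consistent α over) (ψ⊨c (pullback σ α) (⊨-pullback consistent α sat))

⊨C-resp-≡C : ∀ {α c c'} → c ≡C c' → α ⊨C c' → α ⊨C c
⊨C-resp-≡C c≡c' sat = let l , l∈c' , l-true = find sat in
  lose (Equivalence.from (c≡c' l) l∈c') l-true

⊨-resp-⊆≡C : ∀ {α ψ ψ'} → All (λ c → Any (c ≡C_) ψ') ψ → α ⊨ ψ' → α ⊨ ψ
⊨-resp-⊆≡C ψ⊆ψ' sat = All.map (λ c∈ψ' →
  let c' , c'∈ψ' , c≡c' = find c∈ψ' in ⊨C-resp-≡C c≡c' (All.lookup sat c'∈ψ')) ψ⊆ψ'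

proposition1 : (φ₁ φ₂ φ₃ : CNF) (σ : Lit → Lit) (c : Clause) →
    PropConsistent σ φ₂ →
    MapsLits σ φ₂ φ₃ →
    mapCNF σ φ₂ ≡CNF φ₃ →
    ClauseOver c φ₂ →
    φ₂ entails c →
    ∀ (α : Assignment) →
    (α ⊨ (φ₁ ++ φ₂ ++ φ₃)) ⇔ (α ⊨ (mapClause σ c ∷ (φ₁ ++ φ₂ ++ φ₃)))
proposition1 φ₁ φ₂ φ₃ σ c consistent _ (σφ₂⊆φ₃ , _) over φ₂⊨c α =
  mk⇔ (λ sat → σc-holds sat ∷ sat) All.tail
  where
  σc-holds : α ⊨ (φ₁ ++ φ₂ ++ φ₃) → α ⊨C mapClause σ c
  σc-holds sat = entails-image consistent over φ₂⊨c α
    (⊨-resp-⊆≡C σφ₂⊆φ₃ (++⁻ʳ φ₂ (++⁻ʳ φ₁ sat)))
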